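{- Let $\mathcal{H}$ be a pseudohalfplane hypergraph on $V$ with witnessing ABA-free hypergraph $\mathcal{F}$, and let $C$ be its set of extremal vertices with the circular order defined below. Let $p,q\in C$; they are the endpoints of two intervals of the circular order on $C$ (each containing both $p$ and $q$, and together covering $C$). If $H_1\in\mathcal{H}$ contains one of these intervals and $H_2\in\mathcal{H}$ contains the other, then $H_1\cup H_2=V$.
   Context: Let $V=\{v_1<v_2<\dots<v_n\}$ be a finite totally ordered set. A hypergraph $\mathcal{F}$ on $V$ is ABA-free if there are no two hyperedges $A,B\in\mathcal{F}$ and vertices $x<y<z$ with $x,z\in A\setminus B$ and $y\in B\setminus A$. Let $\bar{\mathcal{F}}=\{V\setminus F: F\in\mathcal{F}\}$. $\mathcal{H}$ is a pseudohalfplane hypergraph if $\mathcal{H}\subseteq\mathcal{F}\cup\bar{\mathcal{F}}$ for some ABA-free $\mathcal{F}$ on $V$; fix such an $\mathcal{F}$. A vertex $a$ is skippable in a hypergraph $\mathcal{G}$ on $V$ if some $A\in\mathcal{G}$ has $\min(A)<a<\max(A)$ and $a\notin A$, and unskippable otherwise. Topvertices are the unskippable vertices of $\mathcal{F}$, bottomvertices are the unskippable vertices of $\bar{\mathcal{F}}$; $v_1$ and $v_n$ are both. $C$ is the set of topvertices together with the bottomvertices. Let $t_1=v_1<t_2<\dots<t_k=v_n$ be the topvertices and $b_1=v_1<b_2<\dots<b_l=v_n$ the bottomvertices. The circular order on $C$ is the cyclic sequence $(v_1,t_2,\dots,t_{k-1},v_n,b_{l-1},\dots,b_2)$; an interval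 is a set of cyclically consecutive elements of this sequence. -}

module Defs where

open import Data.Nat using (ℕ)
open import Data.Fin using (Fin; _<_; _≤_)
open import Data.Fin.Subset using (Subset; _∈_; _∉_; ∁)
open import Data.Product using (Σ; _×_; ∃)
open import Data.Sum using (_⊎_)
open import Data.Empty using (⊥)
open import Data.Unit using (⊤)
open import Relation.Nullary using (¬_)
open import Relation.Binary.PropositionalEquality using (_≡_)

-- The ordered vertex set V = {v_1 < ... < v_n} is Fin n with its usual order.
Hypergraph : ℕ → Set₁
Hypergraph n = Subset n → Set

ABAFree : ∀ {n} → Hypergraph n → Set
ABAFree {n} ℱ = ∀ (A B : Subset n) → ℱ A → ℱ B → ∀ (x y z : Fin n) → x < y → y < z →
  ¬ ((x ∈ A × x ∉ B) × (z ∈ A × z ∉ B) × (y ∈ B × y ∉ A))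

Bar : ∀ {n} → Hypergraph n → Hypergraph n
Bar ℱ H = Σ _ λ F → ℱ F × H ≡ ∁ F

-- a is skippable in 𝒢: some A ∈ 𝒢 with min A < a < max A and a ∉ A
-- (min A < a < max A  means some element of A is below a and some above a).
Skippable : ∀ {n} → Hypergraph n → Fin n → Set
Skippable {n} 𝒢 a = Σ (Subset n) λ A → 𝒢 A × Σ (Fin n) λ x → Σ (Fin n) λ z →
  x ∈ A × z ∈ A × x < a × a < z × a ∉ A

Unskippable : ∀ {n} → Hypergraph n → Fin n → Set
Unskippable 𝒢 a = ¬ Skippable 𝒢 a

TopVertex : ∀ {n} → Hypergraph n → Fin n → Set
TopVertex ℱ = Unskippable ℱ

BottomVertex : ∀ {n} → Hypergraph n → Fin n → Set
BottomVertex ℱ = Unskippable (Bar ℱ)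

-- Positions in the cyclic sequence (v_1, t_2, ..., t_{k-1}, v_n, b_{l-1}, ..., b_2):
-- top positions (all topvertices, increasing), then bottom positions
-- (bottomvertices other than v_1, v_n, decreasing).
data Pos (n : ℕ) : Set where
  top : Fin n → Pos n
  bot : Fin n → Pos n

vertex : ∀ {n} → Pos n → Fin n
vertex (top t) = t
vertex (bot b) = b

Interior : ∀ {n} → Fin n → Set
Interior {n} b = (∃ λ (x : Fin n) → x < b) × (∃ λ (z : Fin n) → b < z)

ValidPos : ∀ {n} → Hypergraph n → Pos n → Set
ValidPos ℱ (top t) = TopVertex ℱ t
ValidPos ℱ (bot b) = BottomVertex ℱ b × Interior b

-- The linear order obtained by cutting the cycle just before v_1.
_≤P_ : ∀ {n} → Pos n → Pos n → Set
top t ≤P top t′ = t ≤ t′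
top _ ≤P bot _  = ⊤
bot _ ≤P top _  = ⊥
bot b ≤P bot b′ = b′ ≤ b

-- For positions p ≤P q, the two intervals of the cycle with endpoints p and q.
Arc₁ : ∀ {n} → Pos n → Pos n → Pos n → Set
Arc₁ p q r = p ≤P r × r ≤P q

Arc₂ : ∀ {n} → Pos n → Pos n → Pos n → Set
Arc₂ p q r = q ≤P r ⊎ r ≤P p

ContainsArc : ∀ {n} → Hypergraph n → Subset n → (Pos n → Set) → Set
ContainsArc ℱ H arc = ∀ r → ValidPos ℱ r → arc r → vertex r ∈ H

-- Let G be an edge of an ABA-free 𝒢 missing two unskippable vertices t < t′ and every
-- unskippable vertex between them. A vertex of G between t and t′ is then skipped by an
-- edge with witnesses in [t, t′]. Shrinking this window from the right one vertex at a
-- time preserves the property (this is where ABA-freeness enters), and once the window's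
-- second largest vertex w lies in G, the edge skipping w together with G is an ABA
-- pattern. So G misses all of [t, t′].
-- Applied to ℱ and to the again ABA-free ℱ̄: the complement of an ℱ-edge containing all
-- topvertices of [a, b] (a, b topvertices) contains [a, b], and an ℱ-edge containing all
-- bottomvertices of [a, b] contains [a, b]. As v₁ and vₙ are both top- and bottomvertices,
-- H₁ and H₂ cover intervals of V determined by p and q. Any gap they leave lies strictly
-- between two vertices of C belonging to both, and arises only when one of H₁, H₂ is in ℱ
-- and the other in ℱ̄; then ABA-freeness of ℱ puts the gap into H₁ ∪ H₂.

module Submission where

open import Defs
open import Data.Fin.Subset using (Subset; _∪_; ⊤; _∈_; _∉_; ∁)
open import Data.Sum using (_⊎_; inj₁; inj₂; [_,_]′; swap)
open import Relation.Binary.PropositionalEquality using (_≡_; refl; sym; subst)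

open import Data.Nat as ℕ using (ℕ; zero; suc; z≤n; s≤s⁻¹)
import Data.Nat.Properties as ℕ
open import Data.Fin as Fin using (Fin; toℕ; fromℕ; fromℕ<; _<_; _≤_; _≟_)
open import Data.Fin.Properties using (toℕ-injective; toℕ-fromℕ<; toℕ<n; ≤fromℕ; <-cmp; ≤∧≢⇒<)
open import Data.Fin.Subset.Properties
  using (_∈?_; x∈∁p⇒x∉p; x∉p⇒x∈∁p; x∈p⇒x∉∁p; x∉∁p⇒x∈p; x∈p∪q⁺; ⊆-antisym; ⊆⊤)
open import Data.Product using (Σ; ∃; _×_; _,_)
open import Data.Empty using (⊥-elim)
open import Data.Unit using (tt)
open import Data.Vec using ([])
open import Function using (_∘_)
open import Relation.Nullary using (¬_; yes; no; ¬¬-excluded-middle)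
open import Relation.Binary using (tri<; tri≈; tri>)

abaFree-Bar : ∀ {n} {ℱ : Hypergraph n} → ABAFree ℱ → ABAFree (Bar ℱ)
abaFree-Bar aba _ _ (F , F∈ℱ , refl) (F′ , F′∈ℱ , refl) x y z x<y y<z
  ((x∈A , x∉B) , (z∈A , z∉B) , (y∈B , y∉A)) =
  aba F′ F F′∈ℱ F∈ℱ x y z x<y y<z
    ((x∉∁p⇒x∈p x∉B , x∈∁p⇒x∉p x∈A) , (x∉∁p⇒x∈p z∉B , x∈∁p⇒x∉p z∈A) , (x∉∁p⇒x∈p y∉A , x∈∁p⇒x∉p y∈B))

first-unskippable : ∀ {m} {𝒢 : Hypergraph (suc m)} → Unskippable 𝒢 Fin.zero
first-unskippable (_ , _ , _ , _ , _ , _ , () , _)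

last-unskippable : ∀ {m} {𝒢 : Hypergraph (suc m)} → Unskippable 𝒢 (fromℕ m)
last-unskippable (_ , _ , _ , z , _ , _ , _ , last<z , _) = ℕ.<⇒≱ last<z (≤fromℕ z)

between⇒interior : ∀ {n} {a u b : Fin n} → a < u → u < b → Interior u
between⇒interior {a = a} {b = b} a<u u<b = (a , a<u) , (b , u<b)

module Avoidance {n : ℕ} {𝒢 : Hypergraph n} (aba : ABAFree 𝒢) where

  SkippedWithin : (Fin n → Set) → Fin n → Set
  SkippedWithin W u = Σ (Subset n) λ A → 𝒢 A × u ∉ A ×
    (∃ λ a → a ∈ A × W a × a < u) × (∃ λ b → b ∈ A × W b × u < b)

  -- The vertex set [t, e) ∪ {t′}, with e ≤ t′ wherever it occurs.
  Window : Fin n → ℕ → Fin n → Fin n → Set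
  Window t e t′ x = (t ≤ x × toℕ x ℕ.< e) ⊎ x ≡ t′

  window-left : ∀ {t t′ x : Fin n} {e} → Window t e t′ x → x < t′ → t ≤ x
  window-left (inj₁ (t≤x , _)) _ = t≤x
  window-left (inj₂ refl) x<x = ⊥-elim (ℕ.<-irrefl refl x<x)

  window-below : ∀ {t t′ t″ w x : Fin n} {e} → w < t′ → Window t e t′ x → x < w → Window t (toℕ w) t″ x
  window-below w<t′ Wx x<w = inj₁ (window-left Wx (ℕ.<-trans x<w w<t′) , x<w)

  window-above : ∀ {t w t′ x : Fin n} → Window t (suc (toℕ w)) t′ x → w < x → x ≡ t′
  window-above (inj₁ (_ , x≤w)) w<x = ⊥-elim (ℕ.<⇒≱ w<x (s≤s⁻¹ x≤w))
  window-above (inj₂ x≡t′) _ = x≡t′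

  window-shrink : ∀ {t w t′ x : Fin n} → Window t (suc (toℕ w)) t′ x → Window t (toℕ w) t′ x ⊎ x ≡ w
  window-shrink (inj₂ x≡t′) = inj₁ (inj₂ x≡t′)
  window-shrink (inj₁ (t≤x , x≤w)) with ℕ.m<1+n⇒m<n∨m≡n x≤w
  ... | inj₁ x<w = inj₁ (inj₁ (t≤x , x<w))
  ... | inj₂ x≡w = inj₂ (toℕ-injective x≡w)

  skippable⇒skippedWithin : ∀ {t t′ u : Fin n} → Unskippable 𝒢 t → Unskippable 𝒢 t′ → t < u → u < t′ →
    Skippable 𝒢 u → SkippedWithin (Window t (toℕ t′) t′) u
  skippable⇒skippedWithin {t} {t′} {u} t-unskippable t′-unskippable t<u u<t′
    (A , A∈𝒢 , x , z , x∈A , z∈A , x<u , u<z , u∉A) = A , A∈𝒢 , u∉A , left , right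
    where
    left : ∃ λ a → a ∈ A × Window t (toℕ t′) t′ a × a < u
    left with ℕ.≤-<-connex (toℕ t) (toℕ x)
    ... | inj₁ t≤x = x , x∈A , inj₁ (t≤x , ℕ.<-trans x<u u<t′) , x<u
    ... | inj₂ x<t with t ∈? A
    ...   | yes t∈A = t , t∈A , inj₁ (ℕ.≤-refl , ℕ.<-trans t<u u<t′) , t<u
    ...   | no t∉A = ⊥-elim (t-unskippable
            (A , A∈𝒢 , x , z , x∈A , z∈A , x<t , ℕ.<-trans t<u u<z , t∉A))
    right : ∃ λ b → b ∈ A × Window t (toℕ t′) t′ b × u < b
    right with <-cmp z t′
    ... | tri< z<t′ _ _ = z , z∈A , inj₁ (ℕ.<⇒≤ (ℕ.<-trans t<u u<z) , z<t′) , u<z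
    ... | tri≈ _ z≡t′ _ = z , z∈A , inj₂ z≡t′ , u<z
    ... | tri> _ _ t′<z with t′ ∈? A
    ...   | yes t′∈A = t′ , t′∈A , inj₂ refl , u<t′
    ...   | no t′∉A = ⊥-elim (t′-unskippable
            (A , A∈𝒢 , x , z , x∈A , z∈A , ℕ.<-trans x<u u<t′ , t′<z , t′∉A))

  skippedWithin-dropTop : ∀ {t w t′ u : Fin n} → w < t′ → ¬ SkippedWithin (Window t (suc (toℕ w)) t′) w →
    u < w → SkippedWithin (Window t (suc (toℕ w)) t′) u → SkippedWithin (Window t (toℕ w) w) u
  skippedWithin-dropTop {t} {w} {t′} {u} w<t′ w-unskipped u<w
    (B , B∈𝒢 , u∉B , (a , a∈B , Wa , a<u) , (b , b∈B , Wb , u<b)) =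
    B , B∈𝒢 , u∉B , (a , a∈B , window-below w<t′ Wa a<w , a<u) , right (window-shrink Wb)
    where
    a<w : a < w
    a<w = ℕ.<-trans a<u u<w
    right : Window t (toℕ w) t′ b ⊎ b ≡ w → ∃ λ b → b ∈ B × Window t (toℕ w) w b × u < b
    right (inj₁ (inj₁ b-low)) = b , b∈B , inj₁ b-low , u<b
    right (inj₂ b≡w) = b , b∈B , inj₂ b≡w , u<b
    right (inj₁ (inj₂ b≡t′)) with w ∈? B
    ... | yes w∈B = w , w∈B , inj₂ refl , u<w
    ... | no w∉B = ⊥-elim (w-unskipped (B , B∈𝒢 , w∉B , (a , a∈B , Wa , a<w) ,
            (b , b∈B , Wb , subst (w <_) (sym b≡t′) w<t′)))

  -- If B skips u only through the right witness w, and A skips w with right witness t′,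
  -- then ABA-freeness lets u be skipped with witnesses taken from a, a′ and t′.
  skippedWithin-reroute : ∀ {W : Fin n → Set} {A B : Subset n} {a a′ u w t′ : Fin n} → 𝒢 A → 𝒢 B →
    a′ ∈ A → t′ ∈ A → w ∉ A → a ∈ B → w ∈ B → u ∉ B →
    a < u → a′ < w → u < w → w < t′ → W a → W a′ → W t′ → SkippedWithin W u
  skippedWithin-reroute {A = A} {B} {a} {a′} {u} {w} {t′} A∈𝒢 B∈𝒢 a′∈A t′∈A w∉A a∈B w∈B u∉B
    a<u a′<w u<w w<t′ Wa Wa′ Wt′ with t′ ∈? B | u ∈? A
  ... | yes t′∈B | _ = B , B∈𝒢 , u∉B , (a , a∈B , Wa , a<u) , (t′ , t′∈B , Wt′ , ℕ.<-trans u<w w<t′)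
  ... | no t′∉B | yes u∈A =
    ⊥-elim (aba A B A∈𝒢 B∈𝒢 u w t′ u<w w<t′ ((u∈A , u∉B) , (t′∈A , t′∉B) , (w∈B , w∉A)))
  ... | no _ | no u∉A with <-cmp a′ u
  ...   | tri< a′<u _ _ =
    A , A∈𝒢 , u∉A , (a′ , a′∈A , Wa′ , a′<u) , (t′ , t′∈A , Wt′ , ℕ.<-trans u<w w<t′)
  ...   | tri≈ _ refl _ = ⊥-elim (u∉A a′∈A)
  ...   | tri> _ _ u<a′ with a′ ∈? B | a ∈? A
  ...     | yes a′∈B | _ = B , B∈𝒢 , u∉B , (a , a∈B , Wa , a<u) , (a′ , a′∈B , Wa′ , u<a′)
  ...     | no _ | yes a∈A =
    A , A∈𝒢 , u∉A , (a , a∈A , Wa , a<u) , (t′ , t′∈A , Wt′ , ℕ.<-trans u<w w<t′)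
  ...     | no a′∉B | no a∉A = ⊥-elim (aba B A B∈𝒢 A∈𝒢 a a′ w (ℕ.<-trans a<u u<a′) a′<w
            ((a∈B , a∉A) , (w∈B , w∉A) , (a′∈A , a′∉B)))

  skippedWithin-dropPoint : ∀ {t w t′ u : Fin n} → w < t′ → SkippedWithin (Window t (suc (toℕ w)) t′) w →
    u < w → SkippedWithin (Window t (suc (toℕ w)) t′) u → SkippedWithin (Window t (toℕ w) t′) u
  skippedWithin-dropPoint {t} {w} {t′} {u} w<t′
    (A , A∈𝒢 , w∉A , (a′ , a′∈A , Wa′ , a′<w) , (b′ , b′∈A , Wb′ , w<b′)) u<w
    (B , B∈𝒢 , u∉B , (a , a∈B , Wa , a<u) , (b , b∈B , Wb , u<b)) = by-right (window-shrink Wb)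
    where
    Wa-below : Window t (toℕ w) t′ a
    Wa-below = window-below w<t′ Wa (ℕ.<-trans a<u u<w)
    t′∈A : t′ ∈ A
    t′∈A = subst (_∈ A) (window-above Wb′ w<b′) b′∈A
    by-right : Window t (toℕ w) t′ b ⊎ b ≡ w → SkippedWithin (Window t (toℕ w) t′) u
    by-right (inj₁ Wb-below) = B , B∈𝒢 , u∉B , (a , a∈B , Wa-below , a<u) , (b , b∈B , Wb-below , u<b)
    by-right (inj₂ b≡w) = skippedWithin-reroute A∈𝒢 B∈𝒢 a′∈A t′∈A w∉A a∈B (subst (_∈ B) b≡w b∈B) u∉B
      a<u a′<w u<w w<t′ Wa-below (window-below w<t′ Wa′ a′<w) (inj₂ refl)

  AvoidsBelow : Subset n → ℕ → Set
  AvoidsBelow G e = ∀ {t t′} → e ℕ.≤ toℕ t′ → t ∉ G → t′ ∉ G →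
    (∀ u → t < u → toℕ u ℕ.< e → ¬ SkippedWithin (Window t e t′) u → u ∉ G) →
    ∀ u → t < u → toℕ u ℕ.< e → u ∉ G

  -- The window loses its second largest vertex w: w itself if it is skipped within the
  -- window, and t′ (with w as the new top) otherwise.
  avoids-below-step : ∀ {G : Subset n} → 𝒢 G → ∀ w → AvoidsBelow G (toℕ w) → AvoidsBelow G (suc (toℕ w))
  avoids-below-step {G} G∈𝒢 w avoids-below-w {t} {t′} w<t′ t∉G t′∉G hyp u t<u u≤w u∈G =
    ¬¬-excluded-middle λ where
      (no w-unskipped) → [ (λ u<w → below-w w-unskipped u t<u u<w u∈G)
                         , (λ u≡w → w∉G w-unskipped (subst (_∈ G) u≡w u∈G)) ]′ u<w⊎u≡w
      (yes w-skipped) → [ (λ u<w → below-t′ w-skipped u t<u u<w u∈G)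
                        , (λ u≡w → w-skipped∉G w-skipped (subst (_∈ G) u≡w u∈G)) ]′ u<w⊎u≡w
    where
    u<w⊎u≡w : u < w ⊎ u ≡ w
    u<w⊎u≡w = [ inj₁ , inj₂ ∘ toℕ-injective ]′ (ℕ.m<1+n⇒m<n∨m≡n u≤w)
    t<w : t < w
    t<w = ℕ.<-≤-trans t<u (s≤s⁻¹ u≤w)
    w∉G : ¬ SkippedWithin (Window t (suc (toℕ w)) t′) w → w ∉ G
    w∉G = hyp w t<w ℕ.≤-refl
    below-w : ¬ SkippedWithin (Window t (suc (toℕ w)) t′) w → ∀ v → t < v → v < w → v ∉ G
    below-w w-unskipped = avoids-below-w ℕ.≤-refl t∉G (w∉G w-unskipped)
      λ v t<v v<w v-unskipped → hyp v t<v (ℕ.m<n⇒m<1+n v<w)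
        (v-unskipped ∘ skippedWithin-dropTop w<t′ w-unskipped v<w)
    below-t′ : SkippedWithin (Window t (suc (toℕ w)) t′) w → ∀ v → t < v → v < w → v ∉ G
    below-t′ w-skipped = avoids-below-w (ℕ.<⇒≤ w<t′) t∉G t′∉G
      λ v t<v v<w v-unskipped → hyp v t<v (ℕ.m<n⇒m<1+n v<w)
        (v-unskipped ∘ skippedWithin-dropPoint w<t′ w-skipped v<w)
    w-skipped∉G : SkippedWithin (Window t (suc (toℕ w)) t′) w → w ∉ G
    w-skipped∉G w-skipped@(A , A∈𝒢 , w∉A , (a , a∈A , Wa , a<w) , (b , b∈A , Wb , w<b)) w∈G =
      aba A G A∈𝒢 G∈𝒢 a w t′ a<w w<t′
        ((a∈A , a∉G) , (subst (_∈ A) (window-above Wb w<b) b∈A , t′∉G) , (w∈G , w∉A))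
      where
      a∉G : a ∉ G
      a∉G with ℕ.m≤n⇒m<n∨m≡n (window-left Wa (ℕ.<-trans a<w w<t′))
      ... | inj₁ t<a = below-t′ w-skipped a t<a a<w
      ... | inj₂ t≡a = subst (_∉ G) (toℕ-injective t≡a) t∉G

  avoids-below : ∀ {G : Subset n} → 𝒢 G → ∀ e → AvoidsBelow G e
  avoids-below _ zero _ _ _ _ _ _ ()
  avoids-below G∈𝒢 (suc c) {t′ = t′} c<t′
    with fromℕ< (ℕ.<-trans c<t′ (toℕ<n t′)) | toℕ-fromℕ< (ℕ.<-trans c<t′ (toℕ<n t′))
  ... | w | refl = avoids-below-step G∈𝒢 w (avoids-below G∈𝒢 (toℕ w)) c<t′

  avoids-unskippable⇒avoids-interval : ∀ {G : Subset n} {t t′ : Fin n} → 𝒢 G → Unskippable 𝒢 t → Unskippable 𝒢 t′ →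
    t ∉ G → t′ ∉ G → (∀ u → t < u → u < t′ → Unskippable 𝒢 u → u ∉ G) →
    ∀ v → t ≤ v → v ≤ t′ → v ∉ G
  avoids-unskippable⇒avoids-interval {t = t} {t′} G∈𝒢 t-unskippable t′-unskippable t∉G t′∉G hyp v t≤v v≤t′
    with v ≟ t | v ≟ t′
  ... | yes refl | _ = t∉G
  ... | no _ | yes refl = t′∉G
  ... | no v≢t | no v≢t′ =
    avoids-below G∈𝒢 (toℕ t′) ℕ.≤-refl t∉G t′∉G
      (λ u t<u u<t′ u-unskipped → hyp u t<u u<t′
        (u-unskipped ∘ skippable⇒skippedWithin t-unskippable t′-unskippable t<u u<t′))
      v (≤∧≢⇒< t≤v (v≢t ∘ sym)) (≤∧≢⇒< v≤t′ v≢t′)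

module Spans {n : ℕ} {ℱ : Hypergraph n} (aba : ABAFree ℱ) where

  top-span : ∀ {H : Subset n} {a b : Fin n} → Bar ℱ H → TopVertex ℱ a → TopVertex ℱ b → a ∈ H → b ∈ H →
    (∀ u → a < u → u < b → TopVertex ℱ u → u ∈ H) → ∀ v → a ≤ v → v ≤ b → v ∈ H
  top-span (G , G∈ℱ , refl) a-top b-top a∈H b∈H inner v a≤v v≤b =
    x∉p⇒x∈∁p (avoids-unskippable⇒avoids-interval G∈ℱ a-top b-top (x∈∁p⇒x∉p a∈H) (x∈∁p⇒x∉p b∈H)
      (λ u a<u u<b u-top → x∈∁p⇒x∉p (inner u a<u u<b u-top)) v a≤v v≤b)
    where open Avoidance aba

  bottom-span : ∀ {H : Subset n} {a b : Fin n} → ℱ H → BottomVertex ℱ a → BottomVertex ℱ b → a ∈ H → b ∈ H →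
    (∀ u → a < u → u < b → BottomVertex ℱ u → u ∈ H) → ∀ v → a ≤ v → v ≤ b → v ∈ H
  bottom-span {H} H∈ℱ a-bot b-bot a∈H b∈H inner v a≤v v≤b =
    x∉∁p⇒x∈p (avoids-unskippable⇒avoids-interval (H , H∈ℱ , refl) a-bot b-bot (x∈p⇒x∉∁p a∈H) (x∈p⇒x∉∁p b∈H)
      (λ u a<u u<b u-bot → x∈p⇒x∉∁p (inner u a<u u<b u-bot)) v a≤v v≤b)
    where open Avoidance (abaFree-Bar aba)

  ℱ-Bar-cover : ∀ {F H : Subset n} {x y z : Fin n} → ℱ F → Bar ℱ H → x < y → y < z →
    x ∈ F → z ∈ F → x ∈ H → z ∈ H → y ∈ F ⊎ y ∈ H
  ℱ-Bar-cover {F} {y = y} F∈ℱ (G , G∈ℱ , refl) x<y y<z x∈F z∈F x∈H z∈H with y ∈? F | y ∈? ∁ G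
  ... | yes y∈F | _ = inj₁ y∈F
  ... | no _ | yes y∈H = inj₂ y∈H
  ... | no y∉F | no y∉H = ⊥-elim (aba F G F∈ℱ G∈ℱ _ y _ x<y y<z
        ((x∈F , x∈∁p⇒x∉p x∈H) , (z∈F , x∈∁p⇒x∉p z∈H) , (x∉∁p⇒x∈p y∉H , y∉F)))

trisect : ∀ {n} {P : Fin n → Set} (y x : Fin n) → (∀ v → v ≤ y → P v) →
  (∀ v → y < v → v < x → P v) → (∀ v → x ≤ v → P v) → ∀ v → P v
trisect y x low middle high v with ℕ.≤-<-connex (toℕ v) (toℕ y) | ℕ.<-≤-connex (toℕ v) (toℕ x)
... | inj₁ v≤y | _ = low v v≤y
... | inj₂ y<v | inj₁ v<x = middle v y<v v<x
... | inj₂ _ | inj₂ x≤v = high v x≤v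

module Arcs {m : ℕ} {ℱ : Hypergraph (suc m)} (aba : ABAFree ℱ) {H₁ H₂ : Subset (suc m)} where

  open Spans aba

  PseudoHalfplane : Subset (suc m) → Set
  PseudoHalfplane H = ℱ H ⊎ Bar ℱ H

  Covered : Fin (suc m) → Set
  Covered v = v ∈ H₁ ⊎ v ∈ H₂

  empty-middle : ∀ {x : Fin (suc m)} v → x < v → v < x → Covered v
  empty-middle _ x<v v<x = ⊥-elim (ℕ.<-asym x<v v<x)

  cover-top-top : ∀ {tp tq : Fin (suc m)} → PseudoHalfplane H₁ → PseudoHalfplane H₂ →
    TopVertex ℱ tp → TopVertex ℱ tq → tp ≤ tq →
    ContainsArc ℱ H₁ (Arc₁ (top tp) (top tq)) → ContainsArc ℱ H₂ (Arc₂ (top tp) (top tq)) →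
    ∀ v → Covered v
  cover-top-top {tq = tq} _ (inj₁ H₂∈ℱ) _ _ _ _ c₂ v =
    inj₂ (bottom-span H₂∈ℱ first-unskippable last-unskippable
      (c₂ (top Fin.zero) first-unskippable (inj₂ z≤n)) (c₂ (top (fromℕ m)) last-unskippable (inj₁ (≤fromℕ tq)))
      (λ u 0<u u<last u-bot → c₂ (bot u) (u-bot , between⇒interior 0<u u<last) (inj₁ tt)) v z≤n (≤fromℕ v))
  cover-top-top {tp} {tq} kind₁ (inj₂ H₂∈Bar) tp-top tq-top tp≤tq c₁ c₂ = trisect tp tq low (middle kind₁) high
    where
    tp∈H₁ : tp ∈ H₁
    tp∈H₁ = c₁ (top tp) tp-top (ℕ.≤-refl , tp≤tq)
    tq∈H₁ : tq ∈ H₁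
    tq∈H₁ = c₁ (top tq) tq-top (tp≤tq , ℕ.≤-refl)
    tp∈H₂ : tp ∈ H₂
    tp∈H₂ = c₂ (top tp) tp-top (inj₂ ℕ.≤-refl)
    tq∈H₂ : tq ∈ H₂
    tq∈H₂ = c₂ (top tq) tq-top (inj₁ ℕ.≤-refl)
    low : ∀ v → v ≤ tp → Covered v
    low v v≤tp = inj₂ (top-span H₂∈Bar first-unskippable tp-top
      (c₂ (top Fin.zero) first-unskippable (inj₂ z≤n)) tp∈H₂
      (λ u _ u<tp u-top → c₂ (top u) u-top (inj₂ (ℕ.<⇒≤ u<tp))) v z≤n v≤tp)
    high : ∀ v → tq ≤ v → Covered v
    high v tq≤v = inj₂ (top-span H₂∈Bar tq-top last-unskippable
      tq∈H₂ (c₂ (top (fromℕ m)) last-unskippable (inj₁ (≤fromℕ tq)))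
      (λ u tq<u _ u-top → c₂ (top u) u-top (inj₁ (ℕ.<⇒≤ tq<u))) v tq≤v (≤fromℕ v))
    middle : PseudoHalfplane H₁ → ∀ v → tp < v → v < tq → Covered v
    middle (inj₁ H₁∈ℱ) v tp<v v<tq = ℱ-Bar-cover H₁∈ℱ H₂∈Bar tp<v v<tq tp∈H₁ tq∈H₁ tp∈H₂ tq∈H₂
    middle (inj₂ H₁∈Bar) v tp<v v<tq = inj₁ (top-span H₁∈Bar tp-top tq-top tp∈H₁ tq∈H₁
      (λ u tp<u u<tq u-top → c₁ (top u) u-top (ℕ.<⇒≤ tp<u , ℕ.<⇒≤ u<tq)) v (ℕ.<⇒≤ tp<v) (ℕ.<⇒≤ v<tq))

  cover-top-bot : ∀ {tp bq : Fin (suc m)} → PseudoHalfplane H₁ → PseudoHalfplane H₂ →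
    TopVertex ℱ tp → ValidPos ℱ (bot bq) →
    ContainsArc ℱ H₁ (Arc₁ (top tp) (bot bq)) → ContainsArc ℱ H₂ (Arc₂ (top tp) (bot bq)) →
    ∀ v → Covered v
  cover-top-bot {tp} {bq} kind₁ kind₂ tp-top bq-valid@(bq-bot , _) c₁ c₂ = cases kind₁ kind₂
    where
    tp∈H₁ : tp ∈ H₁
    tp∈H₁ = c₁ (top tp) tp-top (ℕ.≤-refl , tt)
    bq∈H₁ : bq ∈ H₁
    bq∈H₁ = c₁ (bot bq) bq-valid (tt , ℕ.≤-refl)
    tp∈H₂ : tp ∈ H₂
    tp∈H₂ = c₂ (top tp) tp-top (inj₂ ℕ.≤-refl)
    bq∈H₂ : bq ∈ H₂
    bq∈H₂ = c₂ (bot bq) bq-valid (inj₁ ℕ.≤-refl)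
    first∈H₂ : Fin.zero ∈ H₂
    first∈H₂ = c₂ (top Fin.zero) first-unskippable (inj₂ z≤n)
    last∈H₁ : fromℕ m ∈ H₁
    last∈H₁ = c₁ (top (fromℕ m)) last-unskippable (≤fromℕ tp , tt)
    from-bq : ℱ H₁ → ∀ v → bq ≤ v → Covered v
    from-bq H₁∈ℱ v bq≤v = inj₁ (bottom-span H₁∈ℱ bq-bot last-unskippable bq∈H₁ last∈H₁
      (λ u bq<u u<last u-bot → c₁ (bot u) (u-bot , between⇒interior bq<u u<last) (tt , ℕ.<⇒≤ bq<u))
      v bq≤v (≤fromℕ v))
    from-tp : Bar ℱ H₁ → ∀ v → tp ≤ v → Covered v
    from-tp H₁∈Bar v tp≤v = inj₁ (top-span H₁∈Bar tp-top last-unskippable tp∈H₁ last∈H₁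
      (λ u tp<u _ u-top → c₁ (top u) u-top (ℕ.<⇒≤ tp<u , tt)) v tp≤v (≤fromℕ v))
    to-bq : ℱ H₂ → ∀ v → v ≤ bq → Covered v
    to-bq H₂∈ℱ v v≤bq = inj₂ (bottom-span H₂∈ℱ first-unskippable bq-bot first∈H₂ bq∈H₂
      (λ u 0<u u<bq u-bot → c₂ (bot u) (u-bot , between⇒interior 0<u u<bq) (inj₁ (ℕ.<⇒≤ u<bq)))
      v z≤n v≤bq)
    to-tp : Bar ℱ H₂ → ∀ v → v ≤ tp → Covered v
    to-tp H₂∈Bar v v≤tp = inj₂ (top-span H₂∈Bar first-unskippable tp-top first∈H₂ tp∈H₂
      (λ u _ u<tp u-top → c₂ (top u) u-top (inj₂ (ℕ.<⇒≤ u<tp))) v z≤n v≤tp)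
    cases : PseudoHalfplane H₁ → PseudoHalfplane H₂ → ∀ v → Covered v
    cases (inj₁ H₁∈ℱ) (inj₁ H₂∈ℱ) = trisect bq bq (to-bq H₂∈ℱ) empty-middle (from-bq H₁∈ℱ)
    cases (inj₂ H₁∈Bar) (inj₂ H₂∈Bar) = trisect tp tp (to-tp H₂∈Bar) empty-middle (from-tp H₁∈Bar)
    cases (inj₁ H₁∈ℱ) (inj₂ H₂∈Bar) = trisect tp bq (to-tp H₂∈Bar)
      (λ v tp<v v<bq → ℱ-Bar-cover H₁∈ℱ H₂∈Bar tp<v v<bq tp∈H₁ bq∈H₁ tp∈H₂ bq∈H₂) (from-bq H₁∈ℱ)
    cases (inj₂ H₁∈Bar) (inj₁ H₂∈ℱ) = trisect bq tp (to-bq H₂∈ℱ)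
      (λ v bq<v v<tp → swap (ℱ-Bar-cover H₂∈ℱ H₁∈Bar bq<v v<tp bq∈H₂ tp∈H₂ bq∈H₁ tp∈H₁)) (from-tp H₁∈Bar)

  cover-bot-bot : ∀ {bp bq : Fin (suc m)} → PseudoHalfplane H₁ → PseudoHalfplane H₂ →
    ValidPos ℱ (bot bp) → ValidPos ℱ (bot bq) → bq ≤ bp →
    ContainsArc ℱ H₁ (Arc₁ (bot bp) (bot bq)) → ContainsArc ℱ H₂ (Arc₂ (bot bp) (bot bq)) →
    ∀ v → Covered v
  cover-bot-bot _ (inj₂ H₂∈Bar) _ _ _ _ c₂ v =
    inj₂ (top-span H₂∈Bar first-unskippable last-unskippable
      (c₂ (top Fin.zero) first-unskippable (inj₂ tt)) (c₂ (top (fromℕ m)) last-unskippable (inj₂ tt))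
      (λ u _ _ u-top → c₂ (top u) u-top (inj₂ tt)) v z≤n (≤fromℕ v))
  cover-bot-bot {bp} {bq} kind₁ (inj₁ H₂∈ℱ) bp-valid@(bp-bot , _) bq-valid@(bq-bot , _) bq≤bp c₁ c₂ =
    trisect bq bp low (middle kind₁) high
    where
    bp∈H₁ : bp ∈ H₁
    bp∈H₁ = c₁ (bot bp) bp-valid (ℕ.≤-refl , bq≤bp)
    bq∈H₁ : bq ∈ H₁
    bq∈H₁ = c₁ (bot bq) bq-valid (bq≤bp , ℕ.≤-refl)
    bp∈H₂ : bp ∈ H₂
    bp∈H₂ = c₂ (bot bp) bp-valid (inj₂ ℕ.≤-refl)
    bq∈H₂ : bq ∈ H₂
    bq∈H₂ = c₂ (bot bq) bq-valid (inj₁ ℕ.≤-refl)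
    low : ∀ v → v ≤ bq → Covered v
    low v v≤bq = inj₂ (bottom-span H₂∈ℱ first-unskippable bq-bot
      (c₂ (top Fin.zero) first-unskippable (inj₂ tt)) bq∈H₂
      (λ u 0<u u<bq u-bot → c₂ (bot u) (u-bot , between⇒interior 0<u u<bq) (inj₁ (ℕ.<⇒≤ u<bq)))
      v z≤n v≤bq)
    high : ∀ v → bp ≤ v → Covered v
    high v bp≤v = inj₂ (bottom-span H₂∈ℱ bp-bot last-unskippable
      bp∈H₂ (c₂ (top (fromℕ m)) last-unskippable (inj₂ tt))
      (λ u bp<u u<last u-bot → c₂ (bot u) (u-bot , between⇒interior bp<u u<last) (inj₂ (ℕ.<⇒≤ bp<u)))
      v bp≤v (≤fromℕ v))
    middle : PseudoHalfplane H₁ → ∀ v → bq < v → v < bp → Covered v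
    middle (inj₂ H₁∈Bar) v bq<v v<bp = swap (ℱ-Bar-cover H₂∈ℱ H₁∈Bar bq<v v<bp bq∈H₂ bp∈H₂ bq∈H₁ bp∈H₁)
    middle (inj₁ H₁∈ℱ) v bq<v v<bp = inj₁ (bottom-span H₁∈ℱ bq-bot bp-bot bq∈H₁ bp∈H₁
      (λ u bq<u u<bp u-bot → c₁ (bot u) (u-bot , between⇒interior bq<u u<bp) (ℕ.<⇒≤ u<bp , ℕ.<⇒≤ bq<u))
      v (ℕ.<⇒≤ bq<v) (ℕ.<⇒≤ v<bp))

  arcs-cover : PseudoHalfplane H₁ → PseudoHalfplane H₂ →
    ∀ p q → ValidPos ℱ p → ValidPos ℱ q → p ≤P q →
    ContainsArc ℱ H₁ (Arc₁ p q) → ContainsArc ℱ H₂ (Arc₂ p q) → ∀ v → Covered v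
  arcs-cover kind₁ kind₂ (top _) (top _) = cover-top-top kind₁ kind₂
  arcs-cover kind₁ kind₂ (top _) (bot _) p-valid q-valid _ = cover-top-bot kind₁ kind₂ p-valid q-valid
  arcs-cover kind₁ kind₂ (bot _) (bot _) = cover-bot-bot kind₁ kind₂
  arcs-cover _ _ (bot _) (top _) _ _ ()

mainTheorem19 : ∀ {n} (ℱ ℋ : Hypergraph n) → ABAFree ℱ →
    (∀ H → ℋ H → ℱ H ⊎ Bar ℱ H) →
    ∀ (p q : Pos n) → ValidPos ℱ p → ValidPos ℱ q → p ≤P q →
    ∀ (H₁ H₂ : Subset n) → ℋ H₁ → ℋ H₂ →
    ContainsArc ℱ H₁ (Arc₁ p q) → ContainsArc ℱ H₂ (Arc₂ p q) →
    H₁ ∪ H₂ ≡ ⊤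
mainTheorem19 {zero} _ _ _ _ _ _ _ _ _ [] [] _ _ _ _ = refl
mainTheorem19 {suc m} ℱ ℋ aba pseudoHalfplane p q p-valid q-valid p≤q H₁ H₂ H₁∈ℋ H₂∈ℋ c₁ c₂ =
  ⊆-antisym ⊆⊤ λ {v} _ → x∈p∪q⁺
    (arcs-cover (pseudoHalfplane H₁ H₁∈ℋ) (pseudoHalfplane H₂ H₂∈ℋ) p q p-valid q-valid p≤q c₁ c₂ v)
  where open Arcs aba
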